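{- Let $\mathcal R$ be a family of tournaments on a set $V$. The following are equivalent: (i) for all distinct ordered pairs $(x,y),(x',y')\in V\times V\setminus\Delta_V$ there is some $\rho\in\mathcal R$ that separates them; (ii) the family $\mathcal R$ is hereditarily rigid.
   Context: $\Delta_V:=\{(x,x):x\in V\}$. A tournament on $V$ is an irreflexive binary relation $\tau\subseteq V\times V$ such that for all distinct $x,y\in V$ exactly one of $(x,y)\in\tau$, $(y,x)\in\tau$ holds; we write $\tau(x,y)=1$ if $(x,y)\in\tau$ and $0$ otherwise. $\tau$ separates $(x,y),(x',y')$ if $\tau(x,y)\neq\tau(x',y')$. A partial function $f$ on $V$ (a map from a subset ${\rm dom}(f)$ of $V$ to $V$) preserves $\tau$ if $(x,y)\in\tau$ with $x,y\in{\rm dom}(f)$ implies $(f(x),f(y))\in\tau$. The family $\mathcal R$ is hereditarily rigid if every unary partial function on $V$ preserving every member of $\mathcal R$ is a restriction of the identity map or of a constant map. -}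

module Defs where

open import Data.Bool using (Bool; true; false)
open import Data.Maybe using (Maybe; just; nothing)
open import Data.Product using (Σ; _×_; _,_)
open import Data.Sum using (_⊎_)
open import Relation.Binary.PropositionalEquality using (_≡_; _≢_)

-- A tournament on V: an irreflexive relation, given by its characteristic
-- function τ(x,y) ∈ {0,1} (true = 1), such that for distinct x, y exactly one
-- of τ(x,y), τ(y,x) holds.
record Tournament (V : Set) : Set where
  field
    rel     : V → V → Bool
    irrefl  : ∀ x → rel x x ≡ false
    total   : ∀ x y → x ≢ y → (rel x y ≡ true) ⊎ (rel y x ≡ true)
    asym    : ∀ x y → rel x y ≡ true → rel y x ≡ false

open Tournament public

Separates : {V : Set} → Tournament V → V → V → V → V → Set
Separates τ x y x' y' = rel τ x y ≢ rel τ x' y'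

PartialFun : Set → Set
PartialFun V = V → Maybe V

Preserves : {V : Set} → PartialFun V → Tournament V → Set
Preserves {V} f τ = ∀ (x y u v : V) → f x ≡ just u → f y ≡ just v →
  rel τ x y ≡ true → rel τ u v ≡ true

RestrictionOfId : {V : Set} → PartialFun V → Set
RestrictionOfId {V} f = ∀ (x u : V) → f x ≡ just u → u ≡ x

RestrictionOfConst : {V : Set} → PartialFun V → Set
RestrictionOfConst {V} f = Σ V λ c → ∀ (x u : V) → f x ≡ just u → u ≡ c

HereditarilyRigid : {V I : Set} → (I → Tournament V) → Set
HereditarilyRigid {V} {I} R = ∀ (f : PartialFun V) → (∀ i → Preserves f (R i)) →
  RestrictionOfId f ⊎ RestrictionOfConst f

SeparatesOffDiagonalPairs : {V I : Set} → (I → Tournament V) → Set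
SeparatesOffDiagonalPairs {V} {I} R = ∀ (x y x' y' : V) → x ≢ y → x' ≢ y' →
  (x , y) ≢ (x' , y') → Σ I λ i → Separates (R i) x y x' y'

module Submission where

open import Defs
open import Level using (0ℓ)
open import Axiom.ExcludedMiddle using (ExcludedMiddle)
open import Axiom.DoubleNegationElimination using (em⇒dne)
open import Function.Bundles using (_⇔_; mk⇔)
open import Data.Bool using (true; false)
open import Data.Maybe using (just; nothing)
open import Data.Maybe.Properties using (just-injective)
open import Data.Product using (Σ; _×_; _,_; proj₁)
open import Data.Sum using (_⊎_; inj₁; inj₂)
open import Relation.Nullary using (yes; no; ¬_; contradiction)
open import Relation.Binary.Definitions using (DecidableEquality)
open import Relation.Binary.PropositionalEquality

-- (i) ⇒ (ii): a map preserving a tournament carries the value τ(x,y) of every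
-- off-diagonal pair in its domain to the image pair, so if the family
-- separates all such pairs, every pair of distinct points of the domain is
-- fixed; a partial map with this property is a restriction of the identity
-- unless its domain is a single point.
-- (ii) ⇒ (i): if no member separates (x,y) and (x',y'), the two-point map
-- x ↦ x', y ↦ y' preserves the whole family, yet is neither a restriction
-- of the identity nor of a constant map.

module _ {V : Set} (τ : Tournament V) where

  preserves-rel : ∀ {f} → Preserves f τ → ∀ {x y u v} → x ≢ y →
    f x ≡ just u → f y ≡ just v → rel τ x y ≡ rel τ u v
  preserves-rel pres {x} {y} {u} {v} x≢y fx fy with rel τ x y in τxy
  ... | true = sym (pres x y u v fx fy τxy)
  ... | false with total τ x y x≢y
  ...   | inj₁ τxy′ = contradiction (trans (sym τxy′) τxy) λ ()
  ...   | inj₂ τyx = sym (asym τ v u (pres y x v u fy fx τyx))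

  preserves-≢ : ∀ {f} → Preserves f τ → ∀ {x y u v} → x ≢ y →
    f x ≡ just u → f y ≡ just v → u ≢ v
  preserves-≢ pres {x} {y} {u} x≢y fx fy refl with total τ x y x≢y
  ... | inj₁ τxy = contradiction (trans (sym (pres x y u u fx fy τxy)) (irrefl τ u)) λ ()
  ... | inj₂ τyx = contradiction (trans (sym (pres y x u u fy fx τyx)) (irrefl τ u)) λ ()

FixesDistinctPairs : {V : Set} → PartialFun V → Set
FixesDistinctPairs {V} f = ∀ (x y u v : V) → x ≢ y → f x ≡ just u → f y ≡ just v → u ≡ x

fixesDistinctPairs⇒id⊎const : ExcludedMiddle 0ℓ → {V : Set} → (f : PartialFun V) →
  FixesDistinctPairs f → RestrictionOfId f ⊎ RestrictionOfConst f
fixesDistinctPairs⇒id⊎const em {V} f fixes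
  with em {Σ V λ x → Σ V λ u → f x ≡ just u × u ≢ x}
... | no noMoved = inj₁ λ x u fx → em⇒dne em λ u≢x → noMoved (x , u , fx , u≢x)
... | yes (x , u , fx , u≢x) = inj₂ (u , onlyValue)
  where
  onlyValue : ∀ z w → f z ≡ just w → w ≡ u
  onlyValue z w fz with em {z ≡ x}
  ... | yes refl = just-injective (trans (sym fz) fx)
  ... | no z≢x = contradiction (fixes x z u w (λ x≡z → z≢x (sym x≡z)) fx fz) u≢x

module TwoPointMap {V : Set} (_≟_ : DecidableEquality V) (x x′ y y′ : V) where

  twoPoint : PartialFun V
  twoPoint z with z ≟ x | z ≟ y
  ... | yes _ | _     = just x′
  ... | no _  | yes _ = just y′
  ... | no _  | no _  = nothing

  twoPoint-graph : ∀ {z u} → twoPoint z ≡ just u →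
    (z ≡ x × u ≡ x′) ⊎ (z ≡ y × u ≡ y′)
  twoPoint-graph {z} eq with z ≟ x | z ≟ y | eq
  ... | yes z≡x | _       | refl = inj₁ (z≡x , refl)
  ... | no _    | yes z≡y | refl = inj₂ (z≡y , refl)

  twoPoint-x : twoPoint x ≡ just x′
  twoPoint-x with x ≟ x
  ... | yes _   = refl
  ... | no x≢x = contradiction refl x≢x

  twoPoint-y : x ≢ y → twoPoint y ≡ just y′
  twoPoint-y x≢y with y ≟ x | y ≟ y
  ... | yes y≡x | _       = contradiction (sym y≡x) x≢y
  ... | no _    | yes _   = refl
  ... | no _    | no y≢y = contradiction refl y≢y

  twoPoint-preserves : (τ : Tournament V) → x′ ≢ y′ →
    rel τ x y ≡ rel τ x′ y′ → Preserves twoPoint τ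
  twoPoint-preserves τ x′≢y′ same a b u v fa fb τab
    with twoPoint-graph fa | twoPoint-graph fb
  ... | inj₁ (refl , refl) | inj₁ (refl , refl) = contradiction (trans (sym τab) (irrefl τ a)) λ ()
  ... | inj₂ (refl , refl) | inj₂ (refl , refl) = contradiction (trans (sym τab) (irrefl τ a)) λ ()
  ... | inj₁ (refl , refl) | inj₂ (refl , refl) = trans (sym same) τab
  ... | inj₂ (refl , refl) | inj₁ (refl , refl) with total τ x′ y′ x′≢y′
  ...   | inj₂ τy′x′ = τy′x′
  ...   | inj₁ τx′y′ = contradiction (trans (sym τx′y′) (trans (sym same) (asym τ a b τab))) λ ()

  twoPoint-nonrigid : x ≢ y → x′ ≢ y′ → (x , y) ≢ (x′ , y′) →
    ¬ (RestrictionOfId twoPoint ⊎ RestrictionOfConst twoPoint)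
  twoPoint-nonrigid x≢y x′≢y′ pairs≢ (inj₁ isId)
    with isId x x′ twoPoint-x | isId y y′ (twoPoint-y x≢y)
  ... | refl | refl = pairs≢ refl
  twoPoint-nonrigid x≢y x′≢y′ pairs≢ (inj₂ (c , isConst)) =
    x′≢y′ (trans (isConst x x′ twoPoint-x) (sym (isConst y y′ (twoPoint-y x≢y))))

module _ (em : ExcludedMiddle 0ℓ) {V I : Set} (R : I → Tournament V) where

  separating⇒fixesDistinctPairs : SeparatesOffDiagonalPairs R →
    ∀ f → (∀ i → Preserves f (R i)) → FixesDistinctPairs f
  separating⇒fixesDistinctPairs sep f pres x y u v x≢y fx fy
    with em {(x , y) ≡ (u , v)}
  ... | yes pairs≡ = sym (cong proj₁ pairs≡)
  ... | no pairs≢ with sep x y u v x≢y u≢v pairs≢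
    where
    u≢v : u ≢ v
    u≢v with sep x y y x x≢y (λ y≡x → x≢y (sym y≡x)) (λ p → x≢y (cong proj₁ p))
    ... | i , _ = preserves-≢ (R i) (pres i) x≢y fx fy
  ...   | i , separates = contradiction (preserves-rel (R i) (pres i) x≢y fx fy) separates

  rigid⇒separating : HereditarilyRigid R → SeparatesOffDiagonalPairs R
  rigid⇒separating rigid x y x′ y′ x≢y x′≢y′ pairs≢ = em⇒dne em λ noSeparator →
    twoPoint-nonrigid x≢y x′≢y′ pairs≢ (rigid twoPoint λ i →
      twoPoint-preserves (R i) x′≢y′ (em⇒dne em λ differ → noSeparator (i , differ)))
    where open TwoPointMap (λ a b → em) x x′ y y′

lemma3 : ExcludedMiddle 0ℓ → (V I : Set) → (R : I → Tournament V) →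
    SeparatesOffDiagonalPairs R ⇔ HereditarilyRigid R
lemma3 em V I R = mk⇔
  (λ sep f pres → fixesDistinctPairs⇒id⊎const em f
    (separating⇒fixesDistinctPairs em R sep f pres))
  (rigid⇒separating em R)
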